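{- Let $n\ge 2$. For each cyclically zero dense vector $\mathbf v=(v_0,\dots,v_{n-1})\in\{0,1\}^n$ there exists a unique $f\in\mathbb Z_2$ with $T^n(f)=f$ and $\mathbf v^T_{f,n}=\mathbf v$.
   Context: $T:\mathbb Z_2\to\mathbb Z_2$ is the Collatz map on the $2$-adic integers: $T(f)=f/2$ if $f\equiv0\pmod2$ and $T(f)=3f+1$ otherwise. For $f\in\mathbb Z_2$ let $f_0\in\{0,1\}$ with $f\equiv f_0\pmod 2$, and $\mathbf v^T_{f,n}=(T^0(f)_0,T^1(f)_0,\dots,T^{n-1}(f)_0)\in\{0,1\}^n$. A sequence in $\{0,1\}^{\mathbb N}$ is zero dense if it has no two consecutive $1$'s; a vector $(v_0,\dots,v_{n-1})\in\{0,1\}^n$ is cyclically zero dense if its infinite periodic concatenation $(v_0,\dots,v_{n-1},v_0,\dots,v_{n-1},\dots)$ is zero dense. -}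

module Defs where

open import Data.Nat using (ℕ; zero; suc; _%_)
open import Data.Nat.DivMod using (m%n<n)
open import Data.Bool using (Bool; true; false; _∧_; _∨_; _xor_; if_then_else_)
open import Data.Fin using (Fin; fromℕ<; toℕ)
open import Data.Product using (_×_)
open import Relation.Binary.PropositionalEquality using (_≡_)
open import Relation.Nullary using (¬_)

-- 2-adic integers represented by their (infinite) binary digit expansion:
-- f = Σ_k [f k] 2^k, with true = 1, false = 0.  (ℤ₂ ≅ {0,1}^ℕ via digits.)
ℤ₂ : Set
ℤ₂ = ℕ → Bool

_≈₂_ : ℤ₂ → ℤ₂ → Set
f ≈₂ g = ∀ k → f k ≡ g k

parity : ℤ₂ → Bool
parity f = f 0

half : ℤ₂ → ℤ₂
half f k = f (suc k)

double : ℤ₂ → ℤ₂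
double f zero = false
double f (suc k) = f k

maj : Bool → Bool → Bool → Bool
maj a b c = (a ∧ b) ∨ (c ∧ (a xor b))

-- carries of the binary addition f + 2f + 1 (initial carry 1)
carry : ℤ₂ → ℕ → Bool
carry f zero = true
carry f (suc k) = maj (f k) (double f k) (carry f k)

-- 3f + 1 = f + 2f + 1, computed digitwise with carries
threePlusOne : ℤ₂ → ℤ₂
threePlusOne f k = (f k xor double f k) xor carry f k

T : ℤ₂ → ℤ₂
T f = if parity f then threePlusOne f else half f

iter : {A : Set} → (A → A) → ℕ → A → A
iter g zero x = x
iter g (suc n) x = g (iter g n x)

parityVec : (n : ℕ) → ℤ₂ → Fin n → Bool
parityVec n f i = parity (iter T (toℕ i) f)

ZeroDense : (ℕ → Bool) → Set
ZeroDense s = ∀ k → ¬ (s k ≡ true × s (suc k) ≡ true)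

cycle : {n : ℕ} → (Fin n → Bool) → ℕ → Bool
cycle {zero} v k = false
cycle {suc m} v k = v (fromℕ< (m%n<n k (suc m)))

CyclicallyZeroDense : {n : ℕ} → (Fin n → Bool) → Set
CyclicallyZeroDense v = ZeroDense (cycle v)

{-# OPTIONS --safe #-}
-- A 2-adic integer is determined by its parity trajectory m ↦ T^m(f)₀: on even numbers T is
-- halving, on odd ones it is f ↦ 3f + 1, whose k-th digit is f k plus a function of lower
-- digits, so by induction every digit is fixed by finitely many parities.  Conversely every zero
-- dense sequence is a trajectory: read it as blocks 0 and 10 and pull back, f = 2f′ for a 0 and
-- f = (2f″ − 1)/3 for a 10; digit j only depends on an initial segment of the sequence, so f is
-- the limit of the approximations obtained after j steps.  For the periodic sequence s = cycle v
-- this gives f; then T^n f has trajectory shifted by n, which is again s, so T^n f = f, and any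
-- n-periodic g with parity vector v has the n-periodic trajectory s as well, so g = f.
module Submission where

open import Defs
open import Data.Nat using (ℕ; zero; suc; _+_; _*_; _≤_; _<_; s≤s; NonZero; _%_; _/_)
open import Data.Nat.Properties using (n<1+n; n≤1+n; <-≤-trans; m<1+n⇒m<n∨m≡n; +-comm; +-assoc; +-identityʳ)
open import Data.Nat.DivMod using (m%n<n; m≡m%n+[m/n]*n; [m+n]%n≡m%n; m<n⇒m%n≡m)
open import Data.Bool using (Bool; true; false; _xor_; if_then_else_)
open import Data.Bool.Properties using (_≟_; ¬-not; xor-assoc; xor-same; xor-identityʳ)
open import Data.Fin using (Fin; toℕ; fromℕ<)
open import Data.Fin.Properties using (fromℕ<-cong; fromℕ<-toℕ; toℕ-fromℕ<; toℕ<n)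
open import Data.Product using (Σ; _×_; _,_; proj₁; proj₂)
open import Data.Sum using (inj₁; inj₂)
open import Relation.Nullary using (yes; no)
open import Relation.Binary.PropositionalEquality
  using (_≡_; _≗_; refl; sym; trans; cong; cong₂; subst₂; module ≡-Reasoning)

xor-involutiveʳ : ∀ a c → (a xor c) xor c ≡ a
xor-involutiveʳ a c = begin
  (a xor c) xor c  ≡⟨ xor-assoc a c c ⟩
  a xor (c xor c)  ≡⟨ cong (a xor_) (xor-same c) ⟩
  a xor false      ≡⟨ xor-identityʳ a ⟩
  a                ∎
  where open ≡-Reasoning

xor-cancelʳ : ∀ c {a b} → a xor c ≡ b xor c → a ≡ b
xor-cancelʳ c {a} {b} e = begin
  a                ≡⟨ sym (xor-involutiveʳ a c) ⟩
  (a xor c) xor c  ≡⟨ cong (_xor c) e ⟩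
  (b xor c) xor c  ≡⟨ xor-involutiveʳ b c ⟩
  b                ∎
  where open ≡-Reasoning

_≈₂[_]_ : ℤ₂ → ℕ → ℤ₂ → Set
f ≈₂[ k ] g = ∀ j → j < k → f j ≡ g j

≈₂⇒≈₂[] : ∀ {f g} → f ≈₂ g → ∀ k → f ≈₂[ k ] g
≈₂⇒≈₂[] e k j _ = e j

≈₂[]-≤ : ∀ {f g j k} → j ≤ k → f ≈₂[ k ] g → f ≈₂[ j ] g
≈₂[]-≤ j≤k f≈g i i<j = f≈g i (<-≤-trans i<j j≤k)

≈₂[]-extend : ∀ {f g k} → f ≈₂[ k ] g → f k ≡ g k → f ≈₂[ suc k ] g
≈₂[]-extend f≈g e j j<1+k with m<1+n⇒m<n∨m≡n j<1+k
... | inj₁ j<k  = f≈g j j<k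
... | inj₂ refl = e

≈₂[]-half : ∀ {f g k} → f 0 ≡ g 0 → half f ≈₂[ k ] half g → f ≈₂[ suc k ] g
≈₂[]-half e f≈g zero    _         = e
≈₂[]-half e f≈g (suc j) (s≤s j<k) = f≈g j j<k

double-≈₂[] : ∀ {f g k} → f ≈₂[ k ] g → double f ≈₂[ suc k ] double g
double-≈₂[] = ≈₂[]-half refl

carry-≈₂[] : ∀ {f g} k → f ≈₂[ k ] g → carry f k ≡ carry g k
carry-≈₂[] zero    _ = refl
carry-≈₂[] {f} {g} (suc k) f≈g
  rewrite f≈g k (n<1+n k)
        | double-≈₂[] (≈₂[]-≤ (n≤1+n k) f≈g) k (n<1+n k)
        | carry-≈₂[] k (≈₂[]-≤ (n≤1+n k) f≈g) = refl

threePlusOne-digit : ∀ {f g} k → f ≈₂[ suc k ] g → threePlusOne f k ≡ threePlusOne g k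
threePlusOne-digit k f≈g =
  cong₂ _xor_ (cong₂ _xor_ (f≈g k (n<1+n k)) (double-≈₂[] f≈ᵏg k (n<1+n k)))
              (carry-≈₂[] k f≈ᵏg)
  where f≈ᵏg = ≈₂[]-≤ (n≤1+n k) f≈g

threePlusOne-cong : ∀ {f g} → f ≈₂ g → threePlusOne f ≈₂ threePlusOne g
threePlusOne-cong e k = threePlusOne-digit k (≈₂⇒≈₂[] e (suc k))

-- Digit k of 3f+1 is f k ⊕ (a bit determined by the digits below k).
threePlusOne-cancel : ∀ {f g} k → threePlusOne f ≈₂[ k ] threePlusOne g → f ≈₂[ k ] g
threePlusOne-cancel zero    _ j ()
threePlusOne-cancel {f} {g} (suc k) 3f+1≈3g+1 = ≈₂[]-extend f≈ᵏg digit-k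
  where
  f≈ᵏg = threePlusOne-cancel k (≈₂[]-≤ (n≤1+n k) 3f+1≈3g+1)
  digit-k : f k ≡ g k
  digit-k = xor-cancelʳ (double f k) (xor-cancelʳ (carry f k) (trans (3f+1≈3g+1 k (n<1+n k))
    (cong₂ (λ d c → (g k xor d) xor c)
      (sym (double-≈₂[] f≈ᵏg k (n<1+n k))) (sym (carry-≈₂[] k f≈ᵏg)))))

-- Solve x + 2x + 1 = h from the lowest digit up; inverseState h k carries
-- (double x k , carry x k), so that x k = h k ⊕ double x k ⊕ carry x k.
mutual
  threePlusOne⁻¹ : ℤ₂ → ℤ₂
  threePlusOne⁻¹ h k = h k xor (proj₁ (inverseState h k) xor proj₂ (inverseState h k))

  inverseState : ℤ₂ → ℕ → Bool × Bool
  inverseState h zero    = false , true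
  inverseState h (suc k) =
    threePlusOne⁻¹ h k , maj (threePlusOne⁻¹ h k) (proj₁ (inverseState h k)) (proj₂ (inverseState h k))

inverseState-correct : ∀ h k →
  inverseState h k ≡ (double (threePlusOne⁻¹ h) k , carry (threePlusOne⁻¹ h) k)
inverseState-correct h zero    = refl
inverseState-correct h (suc k) =
  cong (λ p → threePlusOne⁻¹ h k , maj (threePlusOne⁻¹ h k) (proj₁ p) (proj₂ p)) (inverseState-correct h k)

threePlusOne-threePlusOne⁻¹ : ∀ h → threePlusOne (threePlusOne⁻¹ h) ≈₂ h
threePlusOne-threePlusOne⁻¹ h k = begin
  (x k xor double x k) xor carry x k  ≡⟨ xor-assoc (x k) _ _ ⟩
  x k xor (double x k xor carry x k)
    ≡⟨ cong (λ p → (h k xor (proj₁ p xor proj₂ p)) xor (double x k xor carry x k))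
            (inverseState-correct h k) ⟩
  (h k xor (double x k xor carry x k)) xor (double x k xor carry x k)  ≡⟨ xor-involutiveʳ (h k) _ ⟩
  h k                                 ∎
  where
  open ≡-Reasoning
  x = threePlusOne⁻¹ h

threePlusOne⁻¹-≈₂[] : ∀ {h h′} k → h ≈₂[ k ] h′ → threePlusOne⁻¹ h ≈₂[ k ] threePlusOne⁻¹ h′
threePlusOne⁻¹-≈₂[] {h} {h′} k h≈h′ = threePlusOne-cancel k λ j j<k →
  trans (threePlusOne-threePlusOne⁻¹ h j) (trans (h≈h′ j j<k) (sym (threePlusOne-threePlusOne⁻¹ h′ j)))

iter-+ : ∀ {A : Set} (g : A → A) m k x → iter g (m + k) x ≡ iter g m (iter g k x)
iter-+ g zero    k x = refl
iter-+ g (suc m) k x = cong g (iter-+ g m k x)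

T-cong : ∀ {f g} → f ≈₂ g → T f ≈₂ T g
T-cong {f} {g} e k with f 0 | g 0 | e 0
... | true  | .true  | refl = threePlusOne-cong e k
... | false | .false | refl = e (suc k)

iter-T-cong : ∀ {f g} → f ≈₂ g → ∀ m → iter T m f ≈₂ iter T m g
iter-T-cong e zero    = e
iter-T-cong e (suc m) = T-cong (iter-T-cong e m)

T-even : ∀ f → f 0 ≡ false → T f ≡ half f
T-even f e rewrite e = refl

T-odd : ∀ f → f 0 ≡ true → T f ≡ threePlusOne f
T-odd f e rewrite e = refl

threePlusOne-odd : ∀ f → f 0 ≡ true → threePlusOne f 0 ≡ false
threePlusOne-odd f e rewrite e = refl

parity-T-odd : ∀ f → f 0 ≡ true → parity (T f) ≡ false
parity-T-odd f e = trans (cong parity (T-odd f e)) (threePlusOne-odd f e)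

T²-odd : ∀ f → f 0 ≡ true → T (T f) ≡ half (threePlusOne f)
T²-odd f e = trans (cong T (T-odd f e)) (T-even (threePlusOne f) (threePlusOne-odd f e))

parities : ℤ₂ → ℕ → Bool
parities f m = parity (iter T m f)

parities-cong : ∀ {f g} → f ≈₂ g → parities f ≗ parities g
parities-cong e m = iter-T-cong e m 0

parities-iter : ∀ n f m → parities (iter T n f) m ≡ parities f (m + n)
parities-iter n f m = cong parity (sym (iter-+ T m n f))

parities-T : ∀ f m → parities (T f) m ≡ parities f (suc m)
parities-T f m = trans (parities-iter 1 f m) (cong (parities f) (+-comm m 1))

parities-periodic : ∀ {n g} → iter T n g ≈₂ g → ∀ m → parities g (m + n) ≡ parities g m
parities-periodic {n} {g} Tⁿg≈g m = trans (sym (parities-iter n g m)) (parities-cong Tⁿg≈g m)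

parities-T-≗ : ∀ {f g} → parities f ≗ parities g → parities (T f) ≗ parities (T g)
parities-T-≗ {f} {g} p m = trans (parities-T f m) (trans (p (suc m)) (sym (parities-T g m)))

parities-injective-below : ∀ k {f g} → parities f ≗ parities g → f ≈₂[ k ] g
parities-injective-below zero _ j ()
parities-injective-below (suc k) {f} {g} p with f 0 in f-parity
... | false = ≈₂[]-half (p 0)
  (subst₂ (_≈₂[ k ]_) (T-even f f-parity) (T-even g g-parity)
    (parities-injective-below k (parities-T-≗ p)))
  where g-parity = trans (sym (p 0)) f-parity
... | true = threePlusOne-cancel (suc k) (≈₂[]-half
  (trans (threePlusOne-odd f f-parity) (sym (threePlusOne-odd g g-parity)))
  (subst₂ (_≈₂[ k ]_) (T²-odd f f-parity) (T²-odd g g-parity)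
    (parities-injective-below k (parities-T-≗ (parities-T-≗ p)))))
  where g-parity = trans (sym (p 0)) f-parity

parities-injective : ∀ {f g} → parities f ≗ parities g → f ≈₂ g
parities-injective p k = parities-injective-below (suc k) p k (n<1+n k)

shift : (ℕ → Bool) → ℕ → Bool
shift s k = s (suc k)

-- A leading 0 of s is undone by doubling, a leading block 1 0 by f ↦ (2f − 1)/3.
approx : ℕ → (ℕ → Bool) → ℤ₂
approx zero    s = λ _ → false
approx (suc k) s =
  if s 0 then threePlusOne⁻¹ (double (approx k (shift (shift s)))) else double (approx k (shift s))

approx-even : ∀ k s → s 0 ≡ false → approx (suc k) s ≡ double (approx k (shift s))
approx-even k s e rewrite e = refl

approx-odd : ∀ k s → s 0 ≡ true → approx (suc k) s ≡ threePlusOne⁻¹ (double (approx k (shift (shift s))))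
approx-odd k s e rewrite e = refl

approx-stable : ∀ {k k′} s → k ≤ k′ → approx k s ≈₂[ k ] approx k′ s
approx-stable {zero} s _ j ()
approx-stable {suc k} {suc k′} s (s≤s k≤k′) with s 0
... | true  = threePlusOne⁻¹-≈₂[] (suc k) (double-≈₂[] (approx-stable (shift (shift s)) k≤k′))
... | false = double-≈₂[] (approx-stable (shift s) k≤k′)

fromParities : (ℕ → Bool) → ℤ₂
fromParities s j = approx (suc j) s j

approx-≈₂[]-fromParities : ∀ k s → approx k s ≈₂[ k ] fromParities s
approx-≈₂[]-fromParities k s j j<k = sym (approx-stable s j<k j (n<1+n j))

fromParities-even : ∀ s → s 0 ≡ false → fromParities s ≈₂ double (fromParities (shift s))
fromParities-even s e j = trans (cong (λ h → h j) (approx-even j s e))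
  (double-≈₂[] (approx-≈₂[]-fromParities j (shift s)) j (n<1+n j))

fromParities-odd : ∀ s → s 0 ≡ true →
  fromParities s ≈₂ threePlusOne⁻¹ (double (fromParities (shift (shift s))))
fromParities-odd s e j = trans (cong (λ h → h j) (approx-odd j s e))
  (threePlusOne⁻¹-≈₂[] (suc j) (double-≈₂[] (approx-≈₂[]-fromParities j (shift (shift s)))) j (n<1+n j))

fromParities-parity : ∀ s → parity (fromParities s) ≡ s 0
fromParities-parity s with s 0
... | false = refl
... | true  = refl

T-fromParities-even : ∀ s → s 0 ≡ false → T (fromParities s) ≈₂ fromParities (shift s)
T-fromParities-even s e k =
  trans (cong (λ h → h k) (T-even (fromParities s) (trans (fromParities-parity s) e))) (fromParities-even s e (suc k))

T²-fromParities-odd : ∀ s → s 0 ≡ true → T (T (fromParities s)) ≈₂ fromParities (shift (shift s))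
T²-fromParities-odd s e k =
  trans (cong (λ h → h k) (T²-odd (fromParities s) (trans (fromParities-parity s) e)))
    (trans (threePlusOne-cong (fromParities-odd s e) (suc k))
      (threePlusOne-threePlusOne⁻¹ (double (fromParities (shift (shift s)))) (suc k)))

zeroDense-next : ∀ {s} → ZeroDense s → ∀ k → s k ≡ true → s (suc k) ≡ false
zeroDense-next z k sₖ≡true = ¬-not λ sₖ₊₁≡true → z k (sₖ≡true , sₖ₊₁≡true)

parities-fromParities : ∀ s → ZeroDense s → parities (fromParities s) ≗ s
parities-fromParities s z zero = fromParities-parity s
parities-fromParities s z (suc m) with s 0 ≟ true | m
... | no s₀≢true | m′ = begin
  parities (fromParities s) (suc m′)    ≡⟨ sym (parities-T (fromParities s) m′) ⟩
  parities (T (fromParities s)) m′      ≡⟨ parities-cong (T-fromParities-even s (¬-not s₀≢true)) m′ ⟩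
  parities (fromParities (shift s)) m′  ≡⟨ parities-fromParities (shift s) (λ k → z (suc k)) m′ ⟩
  s (suc m′)                            ∎
  where open ≡-Reasoning
... | yes s₀≡true | zero =
  trans (parity-T-odd (fromParities s) (trans (fromParities-parity s) s₀≡true))
    (sym (zeroDense-next z 0 s₀≡true))
... | yes s₀≡true | suc m′ = begin
  parities (fromParities s) (suc (suc m′))
    ≡⟨ sym (trans (parities-T (T (fromParities s)) m′) (parities-T (fromParities s) (suc m′))) ⟩
  parities (T (T (fromParities s))) m′  ≡⟨ parities-cong (T²-fromParities-odd s s₀≡true) m′ ⟩
  parities (fromParities (shift (shift s))) m′
    ≡⟨ parities-fromParities (shift (shift s)) (λ k → z (suc (suc k))) m′ ⟩
  s (suc (suc m′))                      ∎
  where open ≡-Reasoning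

periodic-+* : ∀ {A : Set} (a : ℕ → A) n → (∀ m → a (m + n) ≡ a m) → ∀ q r → a (r + q * n) ≡ a r
periodic-+* a n periodic zero    r = cong a (+-identityʳ r)
periodic-+* a n periodic (suc q) r = begin
  a (r + (n + q * n))  ≡⟨ cong a (trans (cong (r +_) (+-comm n (q * n))) (sym (+-assoc r (q * n) n))) ⟩
  a (r + q * n + n)    ≡⟨ periodic (r + q * n) ⟩
  a (r + q * n)        ≡⟨ periodic-+* a n periodic q r ⟩
  a r                  ∎
  where open ≡-Reasoning

periodic-% : ∀ {A : Set} (a : ℕ → A) n .{{_ : NonZero n}} → (∀ m → a (m + n) ≡ a m) →
  ∀ m → a m ≡ a (m % n)
periodic-% a n periodic m =
  trans (cong a (m≡m%n+[m/n]*n m n)) (periodic-+* a n periodic (m / n) (m % n))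

periodic-unique : ∀ {A : Set} (a b : ℕ → A) n .{{_ : NonZero n}} →
  (∀ m → a (m + n) ≡ a m) → (∀ m → b (m + n) ≡ b m) →
  (∀ (i : Fin n) → a (toℕ i) ≡ b (toℕ i)) → a ≗ b
periodic-unique a b n a-periodic b-periodic a≡b m = begin
  a m              ≡⟨ periodic-% a n a-periodic m ⟩
  a (m % n)        ≡⟨ cong a (sym (toℕ-fromℕ< (m%n<n m n))) ⟩
  a (toℕ i)        ≡⟨ a≡b i ⟩
  b (toℕ i)        ≡⟨ cong b (toℕ-fromℕ< (m%n<n m n)) ⟩
  b (m % n)        ≡⟨ sym (periodic-% b n b-periodic m) ⟩
  b m              ∎
  where
  open ≡-Reasoning
  i = fromℕ< (m%n<n m n)

cycle-periodic : ∀ {n} (v : Fin (suc n) → Bool) m → cycle v (m + suc n) ≡ cycle v m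
cycle-periodic {n} v m = cong v (fromℕ<-cong _ _ ([m+n]%n≡m%n m (suc n)) _ _)

cycle-toℕ : ∀ {n} (v : Fin (suc n) → Bool) i → cycle v (toℕ i) ≡ v i
cycle-toℕ v i =
  cong v (trans (fromℕ<-cong _ _ (m<n⇒m%n≡m (toℕ<n i)) _ _) (fromℕ<-toℕ i (toℕ<n i)))

proposition4p8 : (n : ℕ) → 2 ≤ n → (v : Fin n → Bool) → CyclicallyZeroDense v →
    Σ ℤ₂ (λ f → (iter T n f ≈₂ f) × (∀ i → parityVec n f i ≡ v i)
      × (∀ g → iter T n g ≈₂ g → (∀ i → parityVec n g i ≡ v i) → g ≈₂ f))
proposition4p8 (suc n) _ v zeroDense = f , f-periodic , f-parityVec , f-unique
  where
  f = fromParities (cycle v)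
  f-parities : parities f ≗ cycle v
  f-parities = parities-fromParities (cycle v) zeroDense
  f-parityVec : ∀ i → parityVec (suc n) f i ≡ v i
  f-parityVec i = trans (f-parities (toℕ i)) (cycle-toℕ v i)
  f-periodic : iter T (suc n) f ≈₂ f
  f-periodic = parities-injective λ m →
    trans (parities-iter (suc n) f m) (trans (f-parities (m + suc n))
      (trans (cycle-periodic v m) (sym (f-parities m))))
  f-unique : ∀ g → iter T (suc n) g ≈₂ g → (∀ i → parityVec (suc n) g i ≡ v i) → g ≈₂ f
  f-unique g g-periodic g-parityVec = parities-injective
    (periodic-unique (parities g) (parities f) (suc n)
      (parities-periodic g-periodic) (parities-periodic f-periodic)
      λ i → trans (g-parityVec i) (sym (f-parityVec i)))
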